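{- $\mathrm{UCPDL}^+\equiv\mathrm{UNFO}^*$, i.e. $\mathrm{UNFO}^*\le\mathrm{UCPDL}^+$ and $\mathrm{UCPDL}^+\le\mathrm{UNFO}^*$.
   Context: Relation names have arities $\ge1$ (unary: atomic propositions; binary: atomic programs); $\sigma$-structures $K$ have a domain $\mathrm{dom}(K)$ and relations $R^K\subseteq\mathrm{dom}(K)^{\mathrm{ar}(R)}$. $\mathrm{UCPDL}^+$: formulas $\varphi::=p\mid\neg\varphi\mid\varphi\wedge\varphi\mid\langle\pi\rangle$ and programs $\pi::=\varepsilon\mid a\mid\bar a\mid\mathbb U\mid\pi\cup\pi\mid\pi\circ\pi\mid\pi^*\mid\varphi?\mid C[x_s,x_t]$ with semantics $[\![p]\!]=p^K$; complement; intersection; $[\![\langle\pi\rangle]\!]=\{u:\exists v\,(u,v)\in[\![\pi]\!]\}$; identity; $a^K$; converse of $a^K$; $[\![\mathbb U]\!]=\mathrm{dom}(K)^2$; union; composition; reflexive-transitive closure; $\{(u,u):u\in[\![\varphi]\!]\}$. In a conjunctive program $C[x_s,x_t]$, $C$ is a finite set of atoms, each a p-atom $\pi(x,x')$ ($\pi$ a program, $x,x'$ variables) or an r-atom $R(x_1,\dots,x_n)$ with $\mathrm{ar}(R)=n>2$; $x_s,x_t\in\mathrm{Vars}(C)$; the graph on $\mathrm{Vars}(C)$ linking variables occurring in a common atom is connected; $[\![C[x_s,x_t]]\!]_K$ is the set of $(f(x_s),f(x_t))$ for maps $f:\mathrm{Vars}(C)\to\mathrm{dom}(K)$ satisfying all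 atoms. $K,u\models\varphi$ iff $u\in[\![\varphi]\!]_K$; $K,u,v\models\pi$ iff $(u,v)\in[\![\pi]\!]_K$. $\mathrm{UNFO}^*$: first-order formulas $\varphi::=R(\bar x)\mid x=y\mid\varphi\wedge\varphi\mid\varphi\vee\varphi\mid\exists x.\varphi\mid\neg\varphi(x)\mid[\mathrm{TC}_{u,v}\varphi(u,v)](x,y)$, where negation is only applied to formulas with at most one free variable, and $\mathrm{TC}$ only to formulas whose free variables are exactly $\{u,v\}$. Standard first-order semantics, and $K\models[\mathrm{TC}_{u,v}\varphi](x,y)[x\mapsto a,y\mapsto b]$ iff there are $n\ge2$ and $c_1,\dots,c_n\in\mathrm{dom}(K)$ with $c_1=a$, $c_n=b$ and $K\models\varphi[u\mapsto c_i,v\mapsto c_{i+1}]$ for all $i<n$. Comparison: $\mathrm{UNFO}^*\le\mathrm{UCPDL}^+$ means there is a translation $T$ mapping each $\mathrm{UNFO}^*$-formula $\varphi(x)$ with exactly one free variable $x$ to a $\mathrm{UCPDL}^+$-formula with $K\models\varphi[x\mapsto u]$ iff $K,u\models T(\varphi)$, and each $\mathrm{UNFO}^*$-formula $\varphi(x,y)$ with exactly two distinct free variables to a $\mathrm{UCPDL}^+$-program with $K\models\varphi[x\mapsto u,y\mapsto v]$ iff $K,u,v\models T(\varphi)$, for all $\sigma$-structures $K$ and worlds $u,v$. $\mathrm{UCPDL}^+\le\mathrm{UNFO}^*$ means there is a translation mapping each formula $\varphi$ to a $\mathrm{UNFO}^*$-formula $T(\varphi)$ with free variable $x$ such that $K,u\models\varphi$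 iff $K\models T(\varphi)[x\mapsto u]$, and each program $\pi$ to a $\mathrm{UNFO}^*$-formula $T(\pi)$ with free variables $x,y$ such that $K,u,v\models\pi$ iff $K\models T(\pi)[x\mapsto u,y\mapsto v]$. -}

module Defs where

open import Data.Nat using (ℕ; zero; suc; _<_; _≟_)
open import Data.Fin using (Fin)
open import Data.Vec using (Vec; []; _∷_; map)
import Data.Vec.Relation.Unary.Any as VAny
open import Data.List using (List; []; _∷_)
import Data.List.Relation.Unary.Any as LAny
open import Data.Product using (Σ; ∃; _×_; _,_)
open import Data.Sum using (_⊎_)
open import Data.Unit using (⊤)
open import Data.Empty using (⊥)
open import Relation.Nullary using (¬_; yes; no)
open import Relation.Binary.PropositionalEquality using (_≡_; _≢_)
open import Relation.Binary.Construct.Closure.ReflexiveTransitive using (Star)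
open import Relation.Binary.Construct.Closure.Transitive using (TransClosure)
open import Function.Bundles using (_⇔_)

record Signature : Set₁ where
  field
    Rel       : ℕ → Set
    noNullary : Rel 0 → ⊥

module Lang (σ : Signature) where
  open Signature σ

  record Structure : Set₁ where
    field
      Dom : Set
      rel : ∀ {n} → Rel n → Vec Dom n → Set
  open Structure public

  infixr 6 _∧ᶠ_
  infixr 4 _∪ᵖ_
  infixr 5 _∘ᵖ_

  mutual
    data Form : Set where
      prop  : Rel 1 → Form
      ¬ᶠ_   : Form → Form
      _∧ᶠ_  : Form → Form → Form
      ⟨_⟩   : Prog → Form

    data Prog : Set where
      ε     : Prog
      act   : Rel 2 → Prog
      conv  : Rel 2 → Prog
      𝕌     : Prog
      _∪ᵖ_  : Prog → Prog → Prog
      _∘ᵖ_  : Prog → Prog → Prog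
      _*ᵖ   : Prog → Prog
      _?ᵖ   : Form → Prog
      -- conjunctive program C[x_s,x_t] with variables Fin k
      conj  : (k : ℕ) → List (Atom k) → Fin k → Fin k → Prog

    data Atom (k : ℕ) : Set where
      patom : Prog → Fin k → Fin k → Atom k
      ratom : ∀ {n} → Rel n → 2 < n → Vec (Fin k) n → Atom k

  OccA : ∀ {k} → Fin k → Atom k → Set
  OccA z (patom _ x x') = z ≡ x ⊎ z ≡ x'
  OccA z (ratom _ _ xs) = VAny.Any (z ≡_) xs

  Occurs : ∀ {k} → Fin k → List (Atom k) → Set
  Occurs z C = LAny.Any (OccA z) C

  Adj : ∀ {k} → List (Atom k) → Fin k → Fin k → Set
  Adj C z z' = LAny.Any (λ a → OccA z a × OccA z' a) C

  mutual
    WFF : Form → Set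
    WFF (prop _)  = ⊤
    WFF (¬ᶠ φ)    = WFF φ
    WFF (φ ∧ᶠ ψ)  = WFF φ × WFF ψ
    WFF ⟨ π ⟩     = WFP π

    WFP : Prog → Set
    WFP ε            = ⊤
    WFP (act _)      = ⊤
    WFP (conv _)     = ⊤
    WFP 𝕌            = ⊤
    WFP (π ∪ᵖ ρ)     = WFP π × WFP ρ
    WFP (π ∘ᵖ ρ)     = WFP π × WFP ρ
    WFP (π *ᵖ)       = WFP π
    WFP (φ ?ᵖ)       = WFF φ
    WFP (conj k C s t) =
      WFAtoms C × (∀ z → Occurs z C) × (∀ z → Star (Adj C) s z)

    WFAtoms : ∀ {k} → List (Atom k) → Set
    WFAtoms []                  = ⊤
    WFAtoms (patom π _ _ ∷ C)   = WFP π × WFAtoms C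
    WFAtoms (ratom _ _ _ ∷ C)   = WFAtoms C

  Var : Set
  Var = ℕ

  data UForm : Set where
    atomᵘ : ∀ {n} → Rel n → Vec Var n → UForm
    _≐_   : Var → Var → UForm
    _∧ᵘ_  : UForm → UForm → UForm
    _∨ᵘ_  : UForm → UForm → UForm
    ∃ᵘ    : Var → UForm → UForm
    ¬ᵘ    : UForm → UForm
    TC    : Var → Var → UForm → Var → Var → UForm

  Free : Var → UForm → Set
  Free z (atomᵘ R xs)   = VAny.Any (z ≡_) xs
  Free z (x ≐ y)        = z ≡ x ⊎ z ≡ y
  Free z (φ ∧ᵘ ψ)       = Free z φ ⊎ Free z ψ
  Free z (φ ∨ᵘ ψ)       = Free z φ ⊎ Free z ψ
  Free z (∃ᵘ x φ)       = z ≢ x × Free z φ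
  Free z (¬ᵘ φ)         = Free z φ
  Free z (TC u v φ x y) = z ≡ x ⊎ z ≡ y

  WFU : UForm → Set
  WFU (atomᵘ _ _)    = ⊤
  WFU (_ ≐ _)        = ⊤
  WFU (φ ∧ᵘ ψ)       = WFU φ × WFU ψ
  WFU (φ ∨ᵘ ψ)       = WFU φ × WFU ψ
  WFU (∃ᵘ _ φ)       = WFU φ
  WFU (¬ᵘ φ)         = WFU φ × (∀ z z' → Free z φ → Free z' φ → z ≡ z')
  WFU (TC u v φ x y) = WFU φ × u ≢ v × (∀ z → Free z φ ⇔ (z ≡ u ⊎ z ≡ v))

  module Sem (K : Structure) where
    mutual
      semF : Form → Dom K → Set
      semF (prop p) u  = rel K p (u ∷ [])
      semF (¬ᶠ φ) u    = ¬ semF φ u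
      semF (φ ∧ᶠ ψ) u  = semF φ u × semF ψ u
      semF ⟨ π ⟩ u     = ∃ λ v → semP π u v

      semP : Prog → Dom K → Dom K → Set
      semP ε u v          = u ≡ v
      semP (act a) u v    = rel K a (u ∷ v ∷ [])
      semP (conv a) u v   = rel K a (v ∷ u ∷ [])
      semP 𝕌 u v          = ⊤
      semP (π ∪ᵖ ρ) u v   = semP π u v ⊎ semP ρ u v
      semP (π ∘ᵖ ρ) u v   = ∃ λ w → semP π u w × semP ρ w v
      semP (π *ᵖ) u v     = Star (semP π) u v
      semP (φ ?ᵖ) u v     = u ≡ v × semF φ u
      semP (conj k C s t) u v =
        ∃ λ (f : Fin k → Dom K) → SatAll C f × f s ≡ u × f t ≡ v

      SatAll : ∀ {k} → List (Atom k) → (Fin k → Dom K) → Set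
      SatAll [] f      = ⊤
      SatAll (a ∷ C) f = SatA a f × SatAll C f

      SatA : ∀ {k} → Atom k → (Fin k → Dom K) → Set
      SatA (patom π x x') f = semP π (f x) (f x')
      SatA (ratom R _ xs) f = rel K R (map f xs)

    _[_↦_] : (Var → Dom K) → Var → Dom K → Var → Dom K
    (ρ [ x ↦ d ]) z with z ≟ x
    ... | yes _ = d
    ... | no _  = ρ z

    semU : UForm → (Var → Dom K) → Set
    semU (atomᵘ R xs) ρ   = rel K R (map ρ xs)
    semU (x ≐ y) ρ        = ρ x ≡ ρ y
    semU (φ ∧ᵘ ψ) ρ       = semU φ ρ × semU ψ ρ
    semU (φ ∨ᵘ ψ) ρ       = semU φ ρ ⊎ semU ψ ρ
    semU (∃ᵘ x φ) ρ       = ∃ λ d → semU φ (ρ [ x ↦ d ])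
    semU (¬ᵘ φ) ρ         = ¬ semU φ ρ
    semU (TC u v φ x y) ρ =
      TransClosure (λ c d → semU φ ((ρ [ u ↦ c ]) [ v ↦ d ])) (ρ x) (ρ y)

    asg1 : Var → Dom K → Var → Dom K
    asg1 x u = (λ _ → u) [ x ↦ u ]

    asg2 : Var → Var → Dom K → Dom K → Var → Dom K
    asg2 x y u v = ((λ _ → u) [ x ↦ u ]) [ y ↦ v ]

  open Sem public

  UNFO≤UCPDL : Set₁
  UNFO≤UCPDL =
    ((φ : UForm) (x : Var) → WFU φ → (∀ z → Free z φ ⇔ z ≡ x) →
      Σ Form λ ψ → WFF ψ ×
        ((K : Structure) (u : Dom K) → semU K φ (asg1 K x u) ⇔ semF K ψ u))
    ×
    ((φ : UForm) (x y : Var) → WFU φ → x ≢ y →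
      (∀ z → Free z φ ⇔ (z ≡ x ⊎ z ≡ y)) →
      Σ Prog λ π → WFP π ×
        ((K : Structure) (u v : Dom K) →
          semU K φ (asg2 K x y u v) ⇔ semP K π u v))

  xᵛ yᵛ : Var
  xᵛ = 0
  yᵛ = 1

  UCPDL≤UNFO : Set₁
  UCPDL≤UNFO =
    ((φ : Form) → WFF φ →
      Σ UForm λ χ → WFU χ × (∀ z → Free z χ → z ≡ xᵛ) ×
        ((K : Structure) (u : Dom K) → semF K φ u ⇔ semU K χ (asg1 K xᵛ u)))
    ×
    ((π : Prog) → WFP π →
      Σ UForm λ χ → WFU χ × (∀ z → Free z χ → z ≡ xᵛ ⊎ z ≡ yᵛ) ×
        ((K : Structure) (u v : Dom K) →
          semP K π u v ⇔ semU K χ (asg2 K xᵛ yᵛ u v)))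

{-# OPTIONS --safe #-}

-- UCPDL⁺ ≤ UNFO* is the standard translation: fresh variables name the midpoint of a
-- composition, the variables of a conjunctive program and the two ends of a step of π*,
-- which becomes x = y or TC.
--
-- UNFO* ≤ UCPDL⁺: if all variables of φ are below N, φ is equivalent to a finite
-- disjunction of conjunctive queries with N answer variables whose atoms are relation
-- atoms or UCPDL⁺ programs: ∧ multiplies disjunctions out, and ∃ x makes the answer
-- variable x existential.  For answer variables s ≠ t such a disjunction is expressed by a
-- union π of conjunctive programs: π relates a to c iff the disjunction holds when t
-- denotes c and every other variable denotes a.  This gives the program for a formula in
-- x and y, and recursively the atoms ¬⟨π⟩? for a negation (whose formula has at most one
-- free variable) and π ∘ π* for a transitive closure.
module Submission where

open import Data.Empty using (⊥-elim)
open import Data.Fin using (Fin; zero; suc; toℕ; _↑ˡ_; _↑ʳ_; splitAt)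
open import Data.Fin.Properties
  using (toℕ<n; toℕ-fromℕ<; toℕ-injective; splitAt⁻¹-↑ˡ; splitAt⁻¹-↑ʳ; any?)
open import Data.List using (List; []; _∷_; _++_; tabulate)
import Data.List as List
open import Data.List.Extrema.Nat using (max; xs≤max)
open import Data.List.Membership.Propositional using (_∈_)
open import Data.List.Relation.Unary.All as All using (All; []; _∷_)
open import Data.List.Relation.Unary.Any using (Any; here; there)
import Data.List.Relation.Unary.Any.Properties as AnyP
import Data.List.Relation.Unary.All.Properties as AllP
open import Data.Nat using (ℕ; zero; suc; _+_; _<_; _≟_; s≤s; z<s; s<s)
open import Data.Nat.DivMod using (_mod_; m<n⇒m%n≡m)
open import Data.Nat.Properties
  using (m≤n⇒m≤1+n; n<1+n; m<n⇒m<1+n; <⇒≢; +-monoʳ-<; +-identityʳ; +-suc)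
open import Data.Product using (Σ; ∃; _×_; _,_; proj₁; proj₂)
import Data.Product.Function.Dependent.Propositional as Σ
open import Data.Product.Function.NonDependent.Propositional using (_×-⇔_)
open import Data.Sum using (_⊎_; inj₁; inj₂; [_,_]′)
open import Data.Sum.Function.Propositional using (_⊎-⇔_)
open import Data.Unit using (tt)
open import Data.Vec using (Vec; []; _∷_; map; toList)
open import Data.Vec.Properties using (map-∘; map-cong)
import Data.Vec.Functional as V
open import Data.Vec.Functional.Properties using (lookup-++ˡ; lookup-++ʳ; ++-cong)
import Data.Vec.Relation.Unary.Any as VAny
import Data.Vec.Relation.Unary.Any.Properties as VAnyP
open import Function using (_∘_; const; id)
open import Function.Bundles using (_⇔_; mk⇔; Equivalence)
open import Function.Construct.Identity using (⇔-id)
import Function.Properties.Equivalence as ⇔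
open import Function.Properties.Inverse using (↔⇒⇔)
open import Function.Related.Propositional using (module EquationalReasoning; K-reflexive)
open import Function.Related.TypeIsomorphisms using (¬-cong-⇔; Σ-assoc)
open import Relation.Binary.Core using (_⇒_)
open import Relation.Binary.Construct.Closure.ReflexiveTransitive using (Star; ε; _◅_)
open import Relation.Binary.Construct.Closure.Transitive using (TransClosure; [_]; _∷_)
import Relation.Binary.PropositionalEquality as ≡
open import Relation.Binary.PropositionalEquality
  using (_≗_; _≡_; _≢_; refl; sym; trans; cong; cong₂; subst; subst₂)
open import Relation.Nullary using (¬_; Dec; yes; no; ¬?; _⊎-dec_; _×-dec_)

open import Defs

open Equivalence using (to; from)
open EquationalReasoning

private variable
  A : Set
  R S : A → A → Set
  i j k : A

TransClosure-map : R ⇒ S → TransClosure R ⇒ TransClosure S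
TransClosure-map f [ r ]    = [ f r ]
TransClosure-map f (r ∷ rs) = f r ∷ TransClosure-map f rs

TransClosure-cong : (∀ i j → R i j ⇔ S i j) → TransClosure R i j ⇔ TransClosure S i j
TransClosure-cong e = mk⇔ (TransClosure-map (to (e _ _))) (TransClosure-map (from (e _ _)))

_◅⁺_ : R i j → Star R j k → TransClosure R i k
r ◅⁺ ε         = [ r ]
r ◅⁺ (r′ ◅ rs) = r ∷ (r′ ◅⁺ rs)

TransClosure⇒Star : TransClosure R ⇒ Star R
TransClosure⇒Star [ r ]    = r ◅ ε
TransClosure⇒Star (r ∷ rs) = r ◅ TransClosure⇒Star rs

Star⇔≡⊎TransClosure : Star R i j ⇔ (i ≡ j ⊎ TransClosure R i j)
Star⇔≡⊎TransClosure = mk⇔ split [ (λ { refl → ε }) , TransClosure⇒Star ]′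
  where
  split : Star R i j → i ≡ j ⊎ TransClosure R i j
  split ε        = inj₁ refl
  split (r ◅ rs) = inj₂ (r ◅⁺ rs)

TransClosure⇔R∘Star : TransClosure R i j ⇔ (∃ λ k → R i k × Star R k j)
TransClosure⇔R∘Star = mk⇔ uncons (λ (_ , r , rs) → r ◅⁺ rs)
  where
  uncons : TransClosure R i j → ∃ λ k → R i k × Star R k j
  uncons [ r ]    = _ , r , ε
  uncons (r ∷ rs) = _ , r , TransClosure⇒Star rs

module Translations (σ : Signature) where
  open Signature σ
  open Lang σ hiding (semF; semP; SatAll; SatA; semU; _[_↦_]; asg1; asg2)

  module Valuations (K : Structure) where
    open Sem K

    [↦]-updates : ∀ (ρ : Var → Dom K) x d → (ρ [ x ↦ d ]) x ≡ d
    [↦]-updates ρ x d with x ≟ x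
    ... | yes _  = refl
    ... | no x≢x = ⊥-elim (x≢x refl)

    [↦]-minimal : ∀ (ρ : Var → Dom K) {x} d {z} → z ≢ x → (ρ [ x ↦ d ]) z ≡ ρ z
    [↦]-minimal ρ {x} d {z} z≢x with z ≟ x
    ... | yes z≡x = ⊥-elim (z≢x z≡x)
    ... | no _    = refl

    [↦]-cong : ∀ {ρ ρ′ : Var → Dom K} x d {z} → (z ≢ x → ρ z ≡ ρ′ z) →
               (ρ [ x ↦ d ]) z ≡ (ρ′ [ x ↦ d ]) z
    [↦]-cong x d {z} agree with z ≟ x
    ... | yes _  = refl
    ... | no z≢x = agree z≢x

    asg1-const : ∀ x u z → asg1 x u z ≡ u
    asg1-const x u z with z ≟ x
    ... | yes _ = refl
    ... | no _  = refl

    asg2-≗ : ∀ x y u v z → asg2 x y u v z ≡ (const u [ y ↦ v ]) z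
    asg2-≗ x y u v z with z ≟ y
    ... | yes _ = refl
    ... | no _  = asg1-const x u z

    coincidence : ∀ φ → WFU φ → ∀ {ρ ρ′} → (∀ z → Free z φ → ρ z ≡ ρ′ z) → semU φ ρ → semU φ ρ′
    coincidence (atomᵘ R xs) _ agree = subst (rel K R) (map-agree xs λ z → agree z)
      where
      map-agree : ∀ {n ρ ρ′} (xs : Vec Var n) → (∀ z → VAny.Any (z ≡_) xs → ρ z ≡ ρ′ z) →
                  map ρ xs ≡ map ρ′ xs
      map-agree []       agree = refl
      map-agree (x ∷ xs) agree =
        cong₂ _∷_ (agree x (VAny.here refl)) (map-agree xs λ z → agree z ∘ VAny.there)
    coincidence (x ≐ y) _ agree ρx≡ρy =
      trans (sym (agree x (inj₁ refl))) (trans ρx≡ρy (agree y (inj₂ refl)))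
    coincidence (φ ∧ᵘ ψ) (wfφ , wfψ) agree (p , q) =
      coincidence φ wfφ (λ z → agree z ∘ inj₁) p , coincidence ψ wfψ (λ z → agree z ∘ inj₂) q
    coincidence (φ ∨ᵘ ψ) (wfφ , _) agree (inj₁ p) = inj₁ (coincidence φ wfφ (λ z → agree z ∘ inj₁) p)
    coincidence (φ ∨ᵘ ψ) (_ , wfψ) agree (inj₂ q) = inj₂ (coincidence ψ wfψ (λ z → agree z ∘ inj₂) q)
    coincidence (∃ᵘ x φ) wf agree (d , p) =
      d , coincidence φ wf (λ z free → [↦]-cong x d λ z≢x → agree z (z≢x , free)) p
    coincidence (¬ᵘ φ) (wf , _) agree ¬p p′ =
      ¬p (coincidence φ wf (λ z free → sym (agree z free)) p′)
    coincidence (TC u v φ x y) (wf , _ , free-uv) agree steps =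
      subst₂ (TransClosure _) (agree x (inj₁ refl)) (agree y (inj₂ refl))
        (TransClosure-map (λ {c d} → coincidence φ wf (λ z free →
          [↦]-cong v d λ z≢v → [↦]-cong u c λ z≢u → ⊥-elim ([ z≢u , z≢v ]′ (to (free-uv z) free)))) steps)

    coincidence-⇔ : ∀ φ → WFU φ → ∀ {ρ ρ′} → (∀ z → Free z φ → ρ z ≡ ρ′ z) →
                    semU φ ρ ⇔ semU φ ρ′
    coincidence-⇔ φ wf agree =
      mk⇔ (coincidence φ wf agree) (coincidence φ wf λ z free → sym (agree z free))

  module UCPDL→UNFO where

    ⊤ᵘ : Var → UForm
    ⊤ᵘ x = x ≐ x

    ∃ᵘ* : ℕ → ℕ → UForm → UForm
    ∃ᵘ* n zero    ψ = ψ
    ∃ᵘ* n (suc k) ψ = ∃ᵘ n (∃ᵘ* (suc n) k ψ)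

    slot : ℕ → ∀ {k} → Fin k → Var
    slot n j = n + toℕ j

    -- n is the first unused variable; the k variables of a conjunctive program are placed
    -- at the slots n, …, n + k - 1.
    mutual
      trForm : ℕ → Form → Var → UForm
      trForm n (prop p) x = atomᵘ p (x ∷ [])
      trForm n (¬ᶠ φ)   x = ¬ᵘ (trForm n φ x)
      trForm n (φ ∧ᶠ ψ) x = trForm n φ x ∧ᵘ trForm n ψ x
      trForm n ⟨ π ⟩    x = ∃ᵘ n (trProg (suc n) π x n)

      trProg : ℕ → Prog → Var → Var → UForm
      trProg n ε              x y = x ≐ y
      trProg n (act a)        x y = atomᵘ a (x ∷ y ∷ [])
      trProg n (conv a)       x y = atomᵘ a (y ∷ x ∷ [])
      trProg n 𝕌              x y = ⊤ᵘ x ∧ᵘ ⊤ᵘ y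
      trProg n (π ∪ᵖ π′)      x y = trProg n π x y ∨ᵘ trProg n π′ x y
      trProg n (π ∘ᵖ π′)      x y = ∃ᵘ n (trProg (suc n) π x n ∧ᵘ trProg (suc n) π′ n y)
      trProg n (π *ᵖ)         x y = (x ≐ y) ∨ᵘ TC n (suc n) (trStep n π) x y
      trProg n (φ ?ᵖ)         x y = (x ≐ y) ∧ᵘ trForm n φ x
      trProg n (conj k C s t) x y =
        ∃ᵘ* n k (trAtoms n k C ((x ≐ slot n s) ∧ᵘ (y ≐ slot n t)))

      -- ⊤ᵘ n ∧ᵘ ⊤ᵘ (suc n) makes both n and suc n free, as UNFO* demands of a TC body.
      trStep : ℕ → Prog → UForm
      trStep n π = (⊤ᵘ n ∧ᵘ ⊤ᵘ (suc n)) ∧ᵘ trProg (suc (suc n)) π n (suc n)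

      trAtoms : (n k : ℕ) → List (Atom k) → UForm → UForm
      trAtoms n k []                 ψ = ψ
      trAtoms n k (patom π z z′ ∷ C) ψ = trProg (n + k) π (slot n z) (slot n z′) ∧ᵘ trAtoms n k C ψ
      trAtoms n k (ratom R _ zs ∷ C) ψ = atomᵘ R (map (slot n) zs) ∧ᵘ trAtoms n k C ψ

    InSlots : ℕ → ℕ → Var → Set
    InSlots n k z = ∃ λ (j : Fin k) → z ≡ slot n j

    ∃ᵘ*-free : ∀ n k ψ {z} → Free z (∃ᵘ* n k ψ) → Free z ψ × ¬ InSlots n k z
    ∃ᵘ*-free n zero    ψ free = free , λ ()
    ∃ᵘ*-free n (suc k) ψ (z≢n , free) with ∃ᵘ*-free (suc n) k ψ free
    ... | freeψ , outside = freeψ , λ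
      { (zero  , z≡n+0)   → z≢n (trans z≡n+0 (+-identityʳ n))
      ; (suc j , z≡n+1+j) → outside (j , trans z≡n+1+j (+-suc n (toℕ j))) }

    mutual
      trForm-free : ∀ n φ x {z} → Free z (trForm n φ x) → z ≡ x
      trForm-free n (prop p) x (VAny.here z≡x) = z≡x
      trForm-free n (¬ᶠ φ)   x free            = trForm-free n φ x free
      trForm-free n (φ ∧ᶠ ψ) x (inj₁ free)     = trForm-free n φ x free
      trForm-free n (φ ∧ᶠ ψ) x (inj₂ free)     = trForm-free n ψ x free
      trForm-free n ⟨ π ⟩    x (z≢n , free) with trProg-free (suc n) π x n free
      ... | inj₁ z≡x = z≡x
      ... | inj₂ z≡n = ⊥-elim (z≢n z≡n)

      trProg-free : ∀ n π x y {z} → Free z (trProg n π x y) → z ≡ x ⊎ z ≡ y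
      trProg-free n ε        x y free = free
      trProg-free n (act a)  x y (VAny.here z≡x)              = inj₁ z≡x
      trProg-free n (act a)  x y (VAny.there (VAny.here z≡y)) = inj₂ z≡y
      trProg-free n (conv a) x y (VAny.here z≡y)              = inj₂ z≡y
      trProg-free n (conv a) x y (VAny.there (VAny.here z≡x)) = inj₁ z≡x
      trProg-free n 𝕌        x y (inj₁ (inj₁ z≡x)) = inj₁ z≡x
      trProg-free n 𝕌        x y (inj₁ (inj₂ z≡x)) = inj₁ z≡x
      trProg-free n 𝕌        x y (inj₂ (inj₁ z≡y)) = inj₂ z≡y
      trProg-free n 𝕌        x y (inj₂ (inj₂ z≡y)) = inj₂ z≡y
      trProg-free n (π ∪ᵖ π′) x y (inj₁ free) = trProg-free n π x y free
      trProg-free n (π ∪ᵖ π′) x y (inj₂ free) = trProg-free n π′ x y free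
      trProg-free n (π ∘ᵖ π′) x y (z≢n , inj₁ free) with trProg-free (suc n) π x n free
      ... | inj₁ z≡x = inj₁ z≡x
      ... | inj₂ z≡n = ⊥-elim (z≢n z≡n)
      trProg-free n (π ∘ᵖ π′) x y (z≢n , inj₂ free) with trProg-free (suc n) π′ n y free
      ... | inj₁ z≡n = ⊥-elim (z≢n z≡n)
      ... | inj₂ z≡y = inj₂ z≡y
      trProg-free n (π *ᵖ) x y (inj₁ free) = free
      trProg-free n (π *ᵖ) x y (inj₂ free) = free
      trProg-free n (φ ?ᵖ) x y (inj₁ free) = free
      trProg-free n (φ ?ᵖ) x y (inj₂ free) = inj₁ (trForm-free n φ x free)
      trProg-free n (conj k C s t) x y free with ∃ᵘ*-free n k _ free
      ... | free′ , outside with trAtoms-free n k C _ free′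
      ... | inj₂ inSlots                 = ⊥-elim (outside inSlots)
      ... | inj₁ (inj₁ (inj₁ z≡x))       = inj₁ z≡x
      ... | inj₁ (inj₁ (inj₂ z≡s))       = ⊥-elim (outside (s , z≡s))
      ... | inj₁ (inj₂ (inj₁ z≡y))       = inj₂ z≡y
      ... | inj₁ (inj₂ (inj₂ z≡t))       = ⊥-elim (outside (t , z≡t))

      trAtoms-free : ∀ n k (C : List (Atom k)) ψ {z} → Free z (trAtoms n k C ψ) →
                     Free z ψ ⊎ InSlots n k z
      trAtoms-free n k []                 ψ free        = inj₁ free
      trAtoms-free n k (patom π a b ∷ C)  ψ (inj₁ free)
        with trProg-free (n + k) π (slot n a) (slot n b) free
      ... | inj₁ z≡a = inj₂ (a , z≡a)
      ... | inj₂ z≡b = inj₂ (b , z≡b)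
      trAtoms-free n k (patom π a b ∷ C)  ψ (inj₂ free) = trAtoms-free n k C ψ free
      trAtoms-free n k (ratom R _ zs ∷ C) ψ (inj₁ free) = inj₂ (inSlots zs free)
        where
        inSlots : ∀ {l z} (zs : Vec (Fin k) l) → VAny.Any (z ≡_) (map (slot n) zs) →
                  InSlots n k z
        inSlots (a ∷ zs) (VAny.here z≡a)  = a , z≡a
        inSlots (a ∷ zs) (VAny.there any) = inSlots zs any
      trAtoms-free n k (ratom R _ zs ∷ C) ψ (inj₂ free) = trAtoms-free n k C ψ free

    trStep-free : ∀ n π {z} → Free z (trStep n π) ⇔ (z ≡ n ⊎ z ≡ suc n)
    trStep-free n π = mk⇔ free⇒ λ
      { (inj₁ z≡n)   → inj₁ (inj₁ (inj₁ z≡n))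
      ; (inj₂ z≡n+1) → inj₁ (inj₂ (inj₁ z≡n+1)) }
      where
      free⇒ : ∀ {z} → Free z (trStep n π) → z ≡ n ⊎ z ≡ suc n
      free⇒ (inj₁ (inj₁ (inj₁ z≡n)))   = inj₁ z≡n
      free⇒ (inj₁ (inj₁ (inj₂ z≡n)))   = inj₁ z≡n
      free⇒ (inj₁ (inj₂ (inj₁ z≡n+1))) = inj₂ z≡n+1
      free⇒ (inj₁ (inj₂ (inj₂ z≡n+1))) = inj₂ z≡n+1
      free⇒ (inj₂ free)                = trProg-free (suc (suc n)) π n (suc n) free

    ∃ᵘ*-wf : ∀ n k {ψ} → WFU ψ → WFU (∃ᵘ* n k ψ)
    ∃ᵘ*-wf n zero    wf = wf
    ∃ᵘ*-wf n (suc k) wf = ∃ᵘ*-wf (suc n) k wf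

    mutual
      trForm-wf : ∀ n φ x → WFU (trForm n φ x)
      trForm-wf n (prop p) x = tt
      trForm-wf n (¬ᶠ φ)   x = trForm-wf n φ x , λ _ _ free free′ →
        trans (trForm-free n φ x free) (sym (trForm-free n φ x free′))
      trForm-wf n (φ ∧ᶠ ψ) x = trForm-wf n φ x , trForm-wf n ψ x
      trForm-wf n ⟨ π ⟩    x = trProg-wf (suc n) π x n

      trProg-wf : ∀ n π x y → WFU (trProg n π x y)
      trProg-wf n ε         x y = tt
      trProg-wf n (act a)   x y = tt
      trProg-wf n (conv a)  x y = tt
      trProg-wf n 𝕌         x y = tt , tt
      trProg-wf n (π ∪ᵖ π′) x y = trProg-wf n π x y , trProg-wf n π′ x y
      trProg-wf n (π ∘ᵖ π′) x y = trProg-wf (suc n) π x n , trProg-wf (suc n) π′ n y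
      trProg-wf n (π *ᵖ)    x y =
        tt , ((tt , tt) , trProg-wf (suc (suc n)) π n (suc n)) , <⇒≢ (n<1+n n) , λ _ → trStep-free n π
      trProg-wf n (φ ?ᵖ)    x y = tt , trForm-wf n φ x
      trProg-wf n (conj k C s t) x y = ∃ᵘ*-wf n k (trAtoms-wf n k C (tt , tt))

      trAtoms-wf : ∀ n k (C : List (Atom k)) {ψ} → WFU ψ → WFU (trAtoms n k C ψ)
      trAtoms-wf n k []                 wf = wf
      trAtoms-wf n k (patom π a b ∷ C)  wf = trProg-wf (n + k) π (slot n a) (slot n b) , trAtoms-wf n k C wf
      trAtoms-wf n k (ratom R _ zs ∷ C) wf = tt , trAtoms-wf n k C wf

    module Semantics (K : Structure) where
      open Sem K
      open Valuations K

      _[_↦*_] : ∀ {k} → (Var → Dom K) → ℕ → (Fin k → Dom K) → Var → Dom K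
      _[_↦*_] {zero}  ρ n f = ρ
      _[_↦*_] {suc k} ρ n f = (ρ [ n ↦ f zero ]) [ suc n ↦* f ∘ suc ]

      ↦*-below : ∀ {k} ρ n (f : Fin k → Dom K) {z} → z < n → (ρ [ n ↦* f ]) z ≡ ρ z
      ↦*-below {zero}  ρ n f z<n = refl
      ↦*-below {suc k} ρ n f z<n =
        trans (↦*-below (ρ [ n ↦ f zero ]) (suc n) (f ∘ suc) (m<n⇒m<1+n z<n)) ([↦]-minimal ρ _ (<⇒≢ z<n))

      ↦*-slot : ∀ {k} ρ n (f : Fin k → Dom K) j → (ρ [ n ↦* f ]) (slot n j) ≡ f j
      ↦*-slot {suc k} ρ n f zero    rewrite +-identityʳ n =
        trans (↦*-below (ρ [ n ↦ f zero ]) (suc n) (f ∘ suc) (n<1+n n)) ([↦]-updates ρ n _)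
      ↦*-slot {suc k} ρ n f (suc j) rewrite +-suc n (toℕ j) =
        ↦*-slot (ρ [ n ↦ f zero ]) (suc n) (f ∘ suc) j

      ∃ᵘ*-sem : ∀ n k ψ ρ → semU (∃ᵘ* n k ψ) ρ ⇔ ∃ λ (f : Fin k → Dom K) → semU ψ (ρ [ n ↦* f ])
      ∃ᵘ*-sem n zero    ψ ρ = mk⇔ (λ p → (λ ()) , p) proj₂
      ∃ᵘ*-sem n (suc k) ψ ρ = ⇔.trans (Σ.congˡ λ {d} → ∃ᵘ*-sem (suc n) k ψ (ρ [ n ↦ d ]))
        (mk⇔ (λ (d , f , p) → d V.∷ f , p) (λ (f , p) → f zero , f ∘ suc , p))

      fresh : ∀ ρ {n x} d → x < n → (ρ [ n ↦ d ]) x ≡ ρ x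
      fresh ρ d x<n = [↦]-minimal ρ d (<⇒≢ x<n)

      slot< : ∀ n {k} (j : Fin k) → slot n j < n + k
      slot< n j = +-monoʳ-< n (toℕ<n j)

      -- Stated for any a ≡ ρ x, so that the recursive calls at updated valuations need no rewriting.
      mutual
        trForm-sound : ∀ n φ x → x < n → ∀ ρ {a} → ρ x ≡ a → semF φ a ⇔ semU (trForm n φ x) ρ
        trForm-sound n (prop p) x x<n ρ refl = ⇔-id _
        trForm-sound n (¬ᶠ φ)   x x<n ρ ρx   = ¬-cong-⇔ (trForm-sound n φ x x<n ρ ρx)
        trForm-sound n (φ ∧ᶠ ψ) x x<n ρ ρx   = trForm-sound n φ x x<n ρ ρx ×-⇔ trForm-sound n ψ x x<n ρ ρx
        trForm-sound n ⟨ π ⟩    x x<n ρ ρx   = Σ.congˡ λ {d} →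
          trProg-sound (suc n) π x n (m<n⇒m<1+n x<n) (n<1+n n) (ρ [ n ↦ d ])
            (trans (fresh ρ d x<n) ρx) ([↦]-updates ρ n d)

        trProg-sound : ∀ n π x y → x < n → y < n → ∀ ρ {a b} → ρ x ≡ a → ρ y ≡ b →
                       semP π a b ⇔ semU (trProg n π x y) ρ
        trProg-sound n ε         x y x<n y<n ρ refl refl = ⇔-id _
        trProg-sound n (act _)   x y x<n y<n ρ refl refl = ⇔-id _
        trProg-sound n (conv _)  x y x<n y<n ρ refl refl = ⇔-id _
        trProg-sound n 𝕌         x y x<n y<n ρ refl refl = mk⇔ (λ _ → refl , refl) (λ _ → tt)
        trProg-sound n (π ∪ᵖ π′) x y x<n y<n ρ ρx ρy =
          trProg-sound n π x y x<n y<n ρ ρx ρy ⊎-⇔ trProg-sound n π′ x y x<n y<n ρ ρx ρy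
        trProg-sound n (π ∘ᵖ π′) x y x<n y<n ρ ρx ρy = Σ.congˡ λ {d} →
          trProg-sound (suc n) π x n (m<n⇒m<1+n x<n) (n<1+n n) (ρ [ n ↦ d ])
            (trans (fresh ρ d x<n) ρx) ([↦]-updates ρ n d)
          ×-⇔
          trProg-sound (suc n) π′ n y (n<1+n n) (m<n⇒m<1+n y<n) (ρ [ n ↦ d ])
            ([↦]-updates ρ n d) (trans (fresh ρ d y<n) ρy)
        trProg-sound n (π *ᵖ)    x y x<n y<n ρ refl refl =
          ⇔.trans Star⇔≡⊎TransClosure (⇔-id _ ⊎-⇔ TransClosure-cong (trStep-sound n π ρ))
        trProg-sound n (φ ?ᵖ)    x y x<n y<n ρ refl refl = ⇔-id _ ×-⇔ trForm-sound n φ x x<n ρ refl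
        trProg-sound n (conj k C s t) x y x<n y<n ρ refl refl =
          ⇔.trans (Σ.congˡ λ {f} →
                     ⇔.trans (⇔-id _ ×-⇔ (ends f x<n s ×-⇔ ends f y<n t))
                             (trAtoms-sound n k C _ (ρ [ n ↦* f ]) f (↦*-slot ρ n f)))
                  (⇔.sym (∃ᵘ*-sem n k _ ρ))
          where
          ends : ∀ f {z} → z < n → ∀ j →
                 (f j ≡ ρ z) ⇔ ((ρ [ n ↦* f ]) z ≡ (ρ [ n ↦* f ]) (slot n j))
          ends f z<n j rewrite ↦*-below ρ n f z<n | ↦*-slot ρ n f j = mk⇔ sym sym

        trStep-sound : ∀ n π ρ c d → semP π c d ⇔ semU (trStep n π) ((ρ [ n ↦ c ]) [ suc n ↦ d ])
        trStep-sound n π ρ c d = ⇔.trans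
          (trProg-sound (suc (suc n)) π n (suc n) (m<n⇒m<1+n (n<1+n n)) (n<1+n (suc n)) _
            (trans ([↦]-minimal _ d (<⇒≢ (n<1+n n))) ([↦]-updates ρ n c)) ([↦]-updates _ (suc n) d))
          (mk⇔ (λ p → (refl , refl) , p) proj₂)

        trAtoms-sound : ∀ n k (C : List (Atom k)) ψ ρ (f : Fin k → Dom K) →
                        (∀ j → ρ (slot n j) ≡ f j) →
                        (SatAll C f × semU ψ ρ) ⇔ semU (trAtoms n k C ψ) ρ
        trAtoms-sound n k [] ψ ρ f ρ≡f = mk⇔ proj₂ (tt ,_)
        trAtoms-sound n k (patom π a b ∷ C) ψ ρ f ρ≡f = ⇔.trans (↔⇒⇔ Σ-assoc)
          (trProg-sound (n + k) π (slot n a) (slot n b) (slot< n a) (slot< n b) ρ (ρ≡f a) (ρ≡f b)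
           ×-⇔ trAtoms-sound n k C ψ ρ f ρ≡f)
        trAtoms-sound n k (ratom R _ zs ∷ C) ψ ρ f ρ≡f = ⇔.trans (↔⇒⇔ Σ-assoc)
          (K-reflexive (cong (rel K R) (trans (sym (map-cong ρ≡f zs)) (map-∘ ρ (slot n) zs)))
           ×-⇔ trAtoms-sound n k C ψ ρ f ρ≡f)

    -- The translation is correct for all formulas and programs, well-formed or not.
    ucpdl≤unfo : UCPDL≤UNFO
    ucpdl≤unfo =
        (λ φ _ → trForm 1 φ xᵛ , trForm-wf 1 φ xᵛ , (λ _ → trForm-free 1 φ xᵛ) ,
                 λ K u → Semantics.trForm-sound K 1 φ xᵛ z<s (Sem.asg1 K xᵛ u) refl)
      , (λ π _ → trProg 2 π xᵛ yᵛ , trProg-wf 2 π xᵛ yᵛ , (λ _ → trProg-free 2 π xᵛ yᵛ) ,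
                 λ K u v → Semantics.trProg-sound K 2 π xᵛ yᵛ z<s (s<s z<s)
                             (Sem.asg2 K xᵛ yᵛ u v) refl refl)

  module UNFO→UCPDL where

    renameAtom : ∀ {a b} → (Fin a → Fin b) → Atom a → Atom b
    renameAtom r (patom π z z′) = patom π (r z) (r z′)
    renameAtom r (ratom R p zs) = ratom R p (map r zs)

    renameAtoms : ∀ {a b} → (Fin a → Fin b) → List (Atom a) → List (Atom b)
    renameAtoms r = List.map (renameAtom r)

    WFAtoms-rename : ∀ {a b} (r : Fin a → Fin b) C → WFAtoms C → WFAtoms (renameAtoms r C)
    WFAtoms-rename r []                 _          = tt
    WFAtoms-rename r (patom _ _ _ ∷ C)  (wf , wfs) = wf , WFAtoms-rename r C wfs
    WFAtoms-rename r (ratom _ _ _ ∷ C)  wfs        = WFAtoms-rename r C wfs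

    WFAtoms-++ : ∀ {k} (C C′ : List (Atom k)) → WFAtoms C → WFAtoms C′ → WFAtoms (C ++ C′)
    WFAtoms-++ []                 C′ _          wf′ = wf′
    WFAtoms-++ (patom _ _ _ ∷ C)  C′ (wf , wfs) wf′ = wf , WFAtoms-++ C C′ wfs wf′
    WFAtoms-++ (ratom _ _ _ ∷ C)  C′ wfs        wf′ = WFAtoms-++ C C′ wfs wf′

    WFAtoms-tabulate : ∀ {k n} (π : Fin n → Prog) (x y : Fin n → Fin k) → (∀ i → WFP (π i)) →
                       WFAtoms (tabulate λ i → patom (π i) (x i) (y i))
    WFAtoms-tabulate {n = zero}  π x y wf = tt
    WFAtoms-tabulate {n = suc n} π x y wf =
      wf zero , WFAtoms-tabulate (π ∘ suc) (x ∘ suc) (y ∘ suc) (wf ∘ suc)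

    module Satisfaction (K : Structure) where
      open Sem K

      SatAll-cong : ∀ {k} (C : List (Atom k)) {f f′ : Fin k → Dom K} → f ≗ f′ → SatAll C f ⇔ SatAll C f′
      SatAll-cong C f≗f′ = mk⇔ (resp C f≗f′) (resp C (sym ∘ f≗f′))
        where
        resp : ∀ {k} (C : List (Atom k)) {f f′ : Fin k → Dom K} → f ≗ f′ → SatAll C f → SatAll C f′
        resp []                 eq _            = tt
        resp (patom π z z′ ∷ C) eq (sat , sats) = subst₂ (semP π) (eq z) (eq z′) sat , resp C eq sats
        resp (ratom R _ zs ∷ C) eq (sat , sats) = subst (rel K R) (map-cong eq zs) sat , resp C eq sats

      SatAll-rename : ∀ {a b} (r : Fin a → Fin b) C (f : Fin b → Dom K) →
                      SatAll (renameAtoms r C) f ⇔ SatAll C (f ∘ r)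
      SatAll-rename r []                 f = ⇔-id _
      SatAll-rename r (patom π z z′ ∷ C) f = ⇔-id _ ×-⇔ SatAll-rename r C f
      SatAll-rename r (ratom R _ zs ∷ C) f =
        K-reflexive (cong (rel K R) (sym (map-∘ f r zs))) ×-⇔ SatAll-rename r C f

      SatAll-++ : ∀ {k} (C C′ : List (Atom k)) f → SatAll (C ++ C′) f ⇔ (SatAll C f × SatAll C′ f)
      SatAll-++ []      C′ f = mk⇔ (tt ,_) proj₂
      SatAll-++ (a ∷ C) C′ f = ⇔.trans (⇔-id _ ×-⇔ SatAll-++ C C′ f) (⇔.sym (↔⇒⇔ Σ-assoc))

      SatAll-tabulate : ∀ {k n} (h : Fin n → Atom k) f → SatAll (tabulate h) f ⇔ (∀ i → SatA (h i) f)
      SatAll-tabulate {n = zero}  h f = mk⇔ (λ _ ()) (λ _ → tt)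
      SatAll-tabulate {n = suc n} h f = ⇔.trans (⇔-id _ ×-⇔ SatAll-tabulate (h ∘ suc) f)
        (mk⇔ (λ { (sat , sats) zero → sat ; (sat , sats) (suc i) → sats i })
             (λ sats → sats zero , sats ∘ suc))

    vars : UForm → List Var
    vars (atomᵘ R xs)   = toList xs
    vars (x ≐ y)        = x ∷ y ∷ []
    vars (φ ∧ᵘ ψ)       = vars φ ++ vars ψ
    vars (φ ∨ᵘ ψ)       = vars φ ++ vars ψ
    vars (∃ᵘ x φ)       = x ∷ vars φ
    vars (¬ᵘ φ)         = vars φ
    vars (TC u v φ x y) = u ∷ v ∷ x ∷ y ∷ vars φ

    Bounded : ℕ → UForm → Set
    Bounded N φ = All (_< N) (vars φ)

    free⇒∈vars : ∀ φ {z} → Free z φ → z ∈ vars φ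
    free⇒∈vars (atomᵘ R xs)   free        = VAnyP.toList⁺ free
    free⇒∈vars (x ≐ y)        (inj₁ refl) = here refl
    free⇒∈vars (x ≐ y)        (inj₂ refl) = there (here refl)
    free⇒∈vars (φ ∧ᵘ ψ)       (inj₁ free) = AnyP.++⁺ˡ (free⇒∈vars φ free)
    free⇒∈vars (φ ∧ᵘ ψ)       (inj₂ free) = AnyP.++⁺ʳ (vars φ) (free⇒∈vars ψ free)
    free⇒∈vars (φ ∨ᵘ ψ)       (inj₁ free) = AnyP.++⁺ˡ (free⇒∈vars φ free)
    free⇒∈vars (φ ∨ᵘ ψ)       (inj₂ free) = AnyP.++⁺ʳ (vars φ) (free⇒∈vars ψ free)
    free⇒∈vars (∃ᵘ x φ)       (_ , free)  = there (free⇒∈vars φ free)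
    free⇒∈vars (¬ᵘ φ)         free        = free⇒∈vars φ free
    free⇒∈vars (TC u v φ x y) (inj₁ refl) = there (there (here refl))
    free⇒∈vars (TC u v φ x y) (inj₂ refl) = there (there (there (here refl)))

    Free? : ∀ z φ → Dec (Free z φ)
    Free? z (atomᵘ R xs)   = VAny.any? (z ≟_) xs
    Free? z (x ≐ y)        = (z ≟ x) ⊎-dec (z ≟ y)
    Free? z (φ ∧ᵘ ψ)       = Free? z φ ⊎-dec Free? z ψ
    Free? z (φ ∨ᵘ ψ)       = Free? z φ ⊎-dec Free? z ψ
    Free? z (∃ᵘ x φ)       = ¬? (z ≟ x) ×-dec Free? z φ
    Free? z (¬ᵘ φ)         = Free? z φ
    Free? z (TC u v φ x y) = (z ≟ x) ⊎-dec (z ≟ y)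

    bounded-by-max : ∀ zs → All (_< suc (suc (max 0 zs))) zs
    bounded-by-max zs = All.map (λ z≤max → s≤s (m≤n⇒m≤1+n z≤max)) (xs≤max 0 zs)

    module DNF (M : ℕ) where

      -- At least two answer variables, so that every one has a distinct partner `other`.
      N : ℕ
      N = suc (suc M)

      -- Junk for x ≥ N; dnf is only correct for formulas whose variables are all below N.
      var : Var → Fin N
      var x = x mod N

      toℕ-var : ∀ {x} → x < N → toℕ (var x) ≡ x
      toℕ-var x<N = trans (toℕ-fromℕ< _) (m<n⇒m%n≡m x<N)

      var-≢ : ∀ {x y} → x < N → y < N → x ≢ y → var x ≢ var y
      var-≢ x<N y<N x≢y eq = x≢y (trans (sym (toℕ-var x<N)) (trans (cong toℕ eq) (toℕ-var y<N)))

      other : Fin N → Fin N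
      other zero    = suc zero
      other (suc _) = zero

      other-≢ : ∀ i → i ≢ other i
      other-≢ zero    ()
      other-≢ (suc _) ()

      freeVar : UForm → Fin N
      freeVar φ with any? (λ (i : Fin N) → Free? (toℕ i) φ)
      ... | yes (i , _) = i
      ... | no _        = zero

      freeVar-unique : ∀ φ → Bounded N φ → (∀ z z′ → Free z φ → Free z′ φ → z ≡ z′) →
                       ∀ {z} → Free z φ → z ≡ toℕ (freeVar φ)
      freeVar-unique φ b unique {z} free with any? (λ (i : Fin N) → Free? (toℕ i) φ)
      ... | yes (i , freeᵢ) = unique z (toℕ i) free freeᵢ
      ... | no none         = ⊥-elim (none (var z , subst (λ z → Free z φ) (sym (toℕ-var z<N)) free))
        where z<N = All.lookup b (free⇒∈vars φ free)

      -- A conjunctive query: atoms over the N answer variables followed by m existential ones.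
      Query : Set
      Query = Σ ℕ λ m → List (Atom (N + m))

      liftᴱ : ∀ {m m′} → (Fin m → Fin m′) → Fin (N + m) → Fin (N + m′)
      liftᴱ {m′ = m′} r = [ _↑ˡ m′ , (N ↑ʳ_) ∘ r ]′ ∘ splitAt N

      _∧Q_ : Query → Query → Query
      (m₁ , C₁) ∧Q (m₂ , C₂) =
        m₁ + m₂ , renameAtoms (liftᴱ (_↑ˡ m₂)) C₁ ++ renameAtoms (liftᴱ (m₁ ↑ʳ_)) C₂

      -- ∃ x makes the answer variable x the new existential variable zero; nothing refers to
      -- the answer slot x afterwards.
      bindAnswer : Var → ∀ {m} → Fin N → Fin (N + suc m)
      bindAnswer x {m} i with toℕ i ≟ x
      ... | yes _ = N ↑ʳ zero
      ... | no _  = i ↑ˡ suc m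

      bind : Var → ∀ {m} → Fin (N + m) → Fin (N + suc m)
      bind x = [ bindAnswer x , (N ↑ʳ_) ∘ suc ]′ ∘ splitAt N

      ∃Q : Var → Query → Query
      ∃Q x (m , C) = suc m , renameAtoms (bind x) C

      atomQ : Atom (N + 0) → List Query
      atomQ a = (0 , a ∷ []) ∷ []

      progQ : Prog → Fin N → Fin N → List Query
      progQ π i j = atomQ (patom π (i ↑ˡ 0) (j ↑ˡ 0))

      -- r-atoms have arity > 2: unary and binary relations become a test and an atomic program.
      relQ : ∀ {n} → Rel n → Vec (Fin N) n → List Query
      relQ {0}                 R _            = ⊥-elim (noNullary R)
      relQ {1}                 R (i ∷ [])     = progQ (prop R ?ᵖ) i i
      relQ {2}                 R (i ∷ j ∷ []) = progQ (act R) i j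
      relQ {suc (suc (suc n))} R is           = atomQ (ratom R (s<s (s<s z<s)) (map (_↑ˡ 0) is))

      anchor : Fin N → Fin N → Prog
      anchor t i with toℕ i ≟ toℕ t
      ... | yes _ = 𝕌
      ... | no _  = ε

      link : Fin N → ∀ {m} → Fin (N + m) → Prog
      link t = [ anchor t , const 𝕌 ]′ ∘ splitAt N

      -- Every variable is linked to s, which makes the program connected: by ε for the answer
      -- variables other than t, which therefore all denote the value of s, and by 𝕌 otherwise.
      linkAtom : Fin N → Fin N → ∀ {m} → Fin (N + m) → Atom (N + m)
      linkAtom s t {m} z = patom (link t z) (s ↑ˡ m) z

      conjProg : Fin N → Fin N → Query → Prog
      conjProg s t (m , C) = conj (N + m) (C ++ tabulate (linkAtom s t)) (s ↑ˡ m) (t ↑ˡ m)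

      ⊥ᵖ : Prog
      ⊥ᵖ = (¬ᶠ ⟨ 𝕌 ⟩) ?ᵖ

      prog : List Query → Fin N → Fin N → Prog
      prog Qs s t = List.foldr (λ Q π → conjProg s t Q ∪ᵖ π) ⊥ᵖ Qs

      dnf : UForm → List Query
      dnf (atomᵘ R xs)   = relQ R (map var xs)
      dnf (x ≐ y)        = progQ ε (var x) (var y)
      dnf (φ ∧ᵘ ψ)       = List.cartesianProductWith _∧Q_ (dnf φ) (dnf ψ)
      dnf (φ ∨ᵘ ψ)       = dnf φ ++ dnf ψ
      dnf (∃ᵘ x φ)       = List.map (∃Q x) (dnf φ)
      dnf (¬ᵘ φ)         = progQ ((¬ᶠ ⟨ prog (dnf φ) z (other z) ⟩) ?ᵖ) z z
        where z = freeVar φ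
      dnf (TC u v φ x y) = progQ (π ∘ᵖ π *ᵖ) (var x) (var y)
        where π = prog (dnf φ) (var u) (var v)

      WFQuery : Query → Set
      WFQuery (_ , C) = WFAtoms C

      link-wf : ∀ t {m} (z : Fin (N + m)) → WFP (link t z)
      link-wf t z with splitAt N z
      ... | inj₂ _ = tt
      ... | inj₁ i with toℕ i ≟ toℕ t
      ...   | yes _ = tt
      ...   | no _  = tt

      conjProg-wf : ∀ s t Q → WFQuery Q → WFP (conjProg s t Q)
      conjProg-wf s t (m , C) wf =
        WFAtoms-++ C _ wf (WFAtoms-tabulate (link t) (const (s ↑ˡ m)) id (link-wf t)) ,
        (λ z → AnyP.++⁺ʳ C (AnyP.tabulate⁺ {f = linkAtom s t} z (inj₂ refl))) ,
        (λ z → AnyP.++⁺ʳ C (AnyP.tabulate⁺ {f = linkAtom s t} z (inj₁ refl , inj₂ refl)) ◅ ε)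

      prog-wf : ∀ Qs s t → All WFQuery Qs → WFP (prog Qs s t)
      prog-wf []       s t []          = tt
      prog-wf (Q ∷ Qs) s t (wf ∷ wfs) = conjProg-wf s t Q wf , prog-wf Qs s t wfs

      ∧Q-wf : ∀ Q₁ Q₂ → WFQuery Q₁ → WFQuery Q₂ → WFQuery (Q₁ ∧Q Q₂)
      ∧Q-wf (m₁ , C₁) (m₂ , C₂) wf₁ wf₂ = WFAtoms-++ (renameAtoms (liftᴱ (_↑ˡ m₂)) C₁) _
        (WFAtoms-rename _ C₁ wf₁) (WFAtoms-rename (liftᴱ (m₁ ↑ʳ_)) C₂ wf₂)

      relQ-wf : ∀ {n} (R : Rel n) is → All WFQuery (relQ R is)
      relQ-wf {0}                 R _            = ⊥-elim (noNullary R)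
      relQ-wf {1}                 R (i ∷ [])     = (tt , tt) ∷ []
      relQ-wf {2}                 R (i ∷ j ∷ []) = (tt , tt) ∷ []
      relQ-wf {suc (suc (suc n))} R is           = tt ∷ []

      dnf-wf : ∀ φ → All WFQuery (dnf φ)
      dnf-wf (atomᵘ R xs)   = relQ-wf R (map var xs)
      dnf-wf (x ≐ y)        = (tt , tt) ∷ []
      dnf-wf (φ ∧ᵘ ψ)       =
        AllP.cartesianProductWith⁺ (≡.setoid Query) (≡.setoid Query) _∧Q_ (dnf φ) (dnf ψ)
          λ {Q₁ Q₂} Q₁∈ Q₂∈ → ∧Q-wf Q₁ Q₂ (All.lookup (dnf-wf φ) Q₁∈) (All.lookup (dnf-wf ψ) Q₂∈)
      dnf-wf (φ ∨ᵘ ψ)       = AllP.++⁺ (dnf-wf φ) (dnf-wf ψ)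
      dnf-wf (∃ᵘ x φ)       = AllP.map⁺ (All.map (λ {Q} → WFAtoms-rename (bind x) (proj₂ Q)) (dnf-wf φ))
      dnf-wf (¬ᵘ φ)         = (prog-wf (dnf φ) _ _ (dnf-wf φ) , tt) ∷ []
      dnf-wf (TC u v φ x y) = ((wf , wf) , tt) ∷ []
        where wf = prog-wf (dnf φ) (var u) (var v) (dnf-wf φ)

      module Semantics (K : Structure) where
        open Sem K
        open Valuations K
        open Satisfaction K

        restrict : (Var → Dom K) → Fin N → Dom K
        restrict ρ = ρ ∘ toℕ

        QSat : (Fin N → Dom K) → Query → Set
        QSat w (m , C) = ∃ λ (g : Fin m → Dom K) → SatAll C (w V.++ g)

        DSat : (Fin N → Dom K) → List Query → Set
        DSat w = Any (QSat w)

        ++∘liftᴱ : ∀ {m m′} w (g : Fin m′ → Dom K) (r : Fin m → Fin m′) →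
                   (w V.++ g) ∘ liftᴱ r ≗ w V.++ (g ∘ r)
        ++∘liftᴱ w g r z with splitAt N z
        ... | inj₁ i = lookup-++ˡ w g i
        ... | inj₂ j = lookup-++ʳ w g (r j)

        QSat-∧ : ∀ w Q₁ Q₂ → QSat w (Q₁ ∧Q Q₂) ⇔ (QSat w Q₁ × QSat w Q₂)
        QSat-∧ w (m₁ , C₁) (m₂ , C₂) = mk⇔
          (λ (g , sat) → let sat₁ , sat₂ = to (halves g) sat in
                         (g ∘ (_↑ˡ m₂) , sat₁) , (g ∘ (m₁ ↑ʳ_) , sat₂))
          (λ ((g₁ , sat₁) , (g₂ , sat₂)) → g₁ V.++ g₂ , from (halves (g₁ V.++ g₂))
             ( to (SatAll-cong C₁ (++-cong w w (λ _ → refl) (sym ∘ lookup-++ˡ g₁ g₂))) sat₁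
             , to (SatAll-cong C₂ (++-cong w w (λ _ → refl) (sym ∘ lookup-++ʳ g₁ g₂))) sat₂ ))
          where
          part : ∀ {m} (C : List (Atom (N + m))) (r : Fin m → Fin (m₁ + m₂)) g →
                 SatAll (renameAtoms (liftᴱ r) C) (w V.++ g) ⇔ SatAll C (w V.++ (g ∘ r))
          part C r g =
            ⇔.trans (SatAll-rename (liftᴱ r) C (w V.++ g)) (SatAll-cong C (++∘liftᴱ w g r))

          halves : ∀ g → SatAll (proj₂ ((m₁ , C₁) ∧Q (m₂ , C₂))) (w V.++ g) ⇔
                         (SatAll C₁ (w V.++ (g ∘ (_↑ˡ m₂))) × SatAll C₂ (w V.++ (g ∘ (m₁ ↑ʳ_))))
          halves g = ⇔.trans (SatAll-++ _ _ _) (part C₁ (_↑ˡ m₂) g ×-⇔ part C₂ (m₁ ↑ʳ_) g)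

        ++∘bind : ∀ ρ x {m} (g : Fin (suc m) → Dom K) →
                  (restrict ρ V.++ g) ∘ bind x ≗ restrict (ρ [ x ↦ g zero ]) V.++ (g ∘ suc)
        ++∘bind ρ x g z with splitAt N z
        ... | inj₂ j = lookup-++ʳ (restrict ρ) g (suc j)
        ... | inj₁ i with toℕ i ≟ x
        ...   | yes _ = lookup-++ʳ (restrict ρ) g zero
        ...   | no _  = lookup-++ˡ (restrict ρ) g i

        QSat-∃ : ∀ ρ x Q → (∃ λ d → QSat (restrict (ρ [ x ↦ d ])) Q) ⇔ QSat (restrict ρ) (∃Q x Q)
        QSat-∃ ρ x (m , C) = mk⇔
          (λ (d , g , sat) → d V.∷ g , from (renamed (d V.∷ g)) sat)
          (λ (g , sat) → g zero , g ∘ suc , to (renamed g) sat)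
          where
          renamed : ∀ g → SatAll (renameAtoms (bind x) C) (restrict ρ V.++ g) ⇔
                          SatAll C (restrict (ρ [ x ↦ g zero ]) V.++ (g ∘ suc))
          renamed g = ⇔.trans (SatAll-rename (bind x) C _) (SatAll-cong C (++∘bind ρ x g))

        DSat-∧ : ∀ w Qs Qs′ → (DSat w Qs × DSat w Qs′) ⇔ DSat w (List.cartesianProductWith _∧Q_ Qs Qs′)
        DSat-∧ w Qs Qs′ = mk⇔
          (λ (sat , sat′) → AnyP.cartesianProductWith⁺ _∧Q_
                              (λ {Q₁ Q₂} q₁ q₂ → from (QSat-∧ w Q₁ Q₂) (q₁ , q₂)) sat sat′)
          (AnyP.cartesianProductWith⁻ _∧Q_ (to (QSat-∧ w _ _)) Qs Qs′)

        DSat-∃ : ∀ ρ x Qs → (∃ λ d → DSat (restrict (ρ [ x ↦ d ])) Qs) ⇔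
                            DSat (restrict ρ) (List.map (∃Q x) Qs)
        DSat-∃ ρ x Qs = ⇔.trans (mk⇔ AnyP.Any-Σ⁺ʳ AnyP.Any-Σ⁻ʳ)
                          (⇔.trans (AnyP.Any-cong (QSat-∃ ρ x) (⇔-id _)) (↔⇒⇔ AnyP.map↔))

        DSat-atomQ : ∀ w a → DSat w (atomQ a) ⇔ SatA a (w V.++ V.[])
        DSat-atomQ w a = mk⇔
          (λ { (here (g , sat , _)) →
                 proj₁ (to (SatAll-cong (a ∷ []) (++-cong w w (λ _ → refl) λ ())) (sat , tt)) })
          (λ sat → here (V.[] , sat , tt))

        DSat-progQ : ∀ w π i j → DSat w (progQ π i j) ⇔ semP π (w i) (w j)
        DSat-progQ w π i j = ⇔.trans (DSat-atomQ w _)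
          (K-reflexive (cong₂ (semP π) (lookup-++ˡ w V.[] i) (lookup-++ˡ w V.[] j)))

        DSat-relQ : ∀ {n} (R : Rel n) w is → DSat w (relQ R is) ⇔ rel K R (map w is)
        DSat-relQ {0}                 R w _            = ⊥-elim (noNullary R)
        DSat-relQ {1}                 R w (i ∷ [])     = ⇔.trans (DSat-progQ w _ i i) (mk⇔ proj₂ (refl ,_))
        DSat-relQ {2}                 R w (i ∷ j ∷ []) = DSat-progQ w _ i j
        DSat-relQ {suc (suc (suc n))} R w is           = ⇔.trans (DSat-atomQ w _)
          (K-reflexive (cong (rel K R) (trans (sym (map-∘ _ _ is)) (map-cong (lookup-++ˡ w V.[]) is))))

        conjProg-sem : ∀ {s t} → s ≢ t → ∀ a c Q →
                       semP (conjProg s t Q) a c ⇔ QSat (restrict (const a [ toℕ t ↦ c ])) Q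
        conjProg-sem {s} {t} s≢t a c (m , C) = mk⇔ sound complete
          where
          w = restrict (const a [ toℕ t ↦ c ])

          ws≡a : w s ≡ a
          ws≡a = [↦]-minimal (const a) c (s≢t ∘ toℕ-injective)

          sound : semP (conjProg s t (m , C)) a c → QSat w (m , C)
          sound (f , sat , fs≡a , ft≡c) = f ∘ (N ↑ʳ_) , to (SatAll-cong C f≗) satC
            where
            satC = proj₁ (to (SatAll-++ C _ f) sat)
            linked = to (SatAll-tabulate (linkAtom s t) f) (proj₂ (to (SatAll-++ C _ f) sat))
            f≗ : f ≗ w V.++ (f ∘ (N ↑ʳ_))
            f≗ z with splitAt N z in eq | linked z
            ... | inj₂ j | _ = cong f (sym (splitAt⁻¹-↑ʳ eq))
            ... | inj₁ i | linkedᵢ with toℕ i ≟ toℕ t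
            ...   | yes i≡t =
              trans (cong f (trans (sym (splitAt⁻¹-↑ˡ eq)) (cong (_↑ˡ m) (toℕ-injective i≡t)))) ft≡c
            ...   | no _    = trans (sym linkedᵢ) fs≡a

          complete : QSat w (m , C) → semP (conjProg s t (m , C)) a c
          complete (g , satC) =
            w V.++ g , from (SatAll-++ C _ _) (satC , from (SatAll-tabulate (linkAtom s t) _) linked) ,
            trans (lookup-++ˡ w g s) ws≡a , trans (lookup-++ˡ w g t) ([↦]-updates (const a) (toℕ t) c)
            where
            linked : ∀ z → semP (link t z) ((w V.++ g) (s ↑ˡ m)) ((w V.++ g) z)
            linked z with splitAt N z
            ... | inj₂ _ = tt
            ... | inj₁ i with toℕ i ≟ toℕ t
            ...   | yes _ = tt
            ...   | no _  = trans (lookup-++ˡ w g s) ws≡a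

        prog-sem : ∀ {s t} → s ≢ t → ∀ a c Qs →
                   semP (prog Qs s t) a c ⇔ DSat (restrict (const a [ toℕ t ↦ c ])) Qs
        prog-sem s≢t a c []       = mk⇔ (λ (_ , ¬⟨𝕌⟩) → ⊥-elim (¬⟨𝕌⟩ (a , tt))) λ ()
        prog-sem s≢t a c (Q ∷ Qs) =
          ⇔.trans (conjProg-sem s≢t a c Q ⊎-⇔ prog-sem s≢t a c Qs) (↔⇒⇔ (AnyP.∷↔ _))

        Represents : List Query → UForm → Set
        Represents Qs φ = ∀ ρ → semU φ ρ ⇔ DSat (restrict ρ) Qs

        prog-represents : ∀ {Qs} φ → Represents Qs φ → ∀ {s t} → s ≢ t → ∀ a c →
                          semP (prog Qs s t) a c ⇔ semU φ (const a [ toℕ t ↦ c ])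
        prog-represents φ rep s≢t a c = ⇔.trans (prog-sem s≢t a c _) (⇔.sym (rep _))

        ⟨prog⟩-represents : ∀ {Qs} φ → Represents Qs φ → WFU φ → ∀ s → (∀ {z} → Free z φ → z ≡ toℕ s) →
                            ∀ ρ → semU φ ρ ⇔ semF ⟨ prog Qs s (other s) ⟩ (ρ (toℕ s))
        ⟨prog⟩-represents φ rep wf s only-s ρ = mk⇔
          (λ p → a , from (prog-represents φ rep (other-≢ s) a a) (coincidence φ wf (agree a) p))
          (λ (c , q) → coincidence φ wf (λ z free → sym (agree c z free))
                                     (to (prog-represents φ rep (other-≢ s) a c) q))
          where
          a = ρ (toℕ s)
          agree : ∀ c z → Free z φ → ρ z ≡ (const a [ toℕ (other s) ↦ c ]) z
          agree c z free rewrite only-s free = sym ([↦]-minimal (const a) c (other-≢ s ∘ toℕ-injective))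

        restrict∘var : ∀ ρ {x} → x < N → restrict ρ (var x) ≡ ρ x
        restrict∘var ρ x<N = cong ρ (toℕ-var x<N)

        map-restrict∘var : ∀ ρ {n} (xs : Vec Var n) → All (_< N) (toList xs) →
                           map (restrict ρ ∘ var) xs ≡ map ρ xs
        map-restrict∘var ρ []       []         = refl
        map-restrict∘var ρ (x ∷ xs) (x< ∷ xs<) = cong₂ _∷_ (restrict∘var ρ x<) (map-restrict∘var ρ xs xs<)

        dnf-represents : ∀ φ → Bounded N φ → WFU φ → Represents (dnf φ) φ
        dnf-represents (atomᵘ R xs) b _ ρ = ⇔.sym (⇔.trans (DSat-relQ R _ (map var xs))
          (K-reflexive (cong (rel K R) (trans (sym (map-∘ _ _ xs)) (map-restrict∘var ρ xs b)))))
        dnf-represents (x ≐ y) (x< ∷ y< ∷ []) _ ρ = ⇔.sym (⇔.trans (DSat-progQ _ ε _ _)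
          (K-reflexive (cong₂ _≡_ (restrict∘var ρ x<) (restrict∘var ρ y<))))
        dnf-represents (φ ∧ᵘ ψ) b (wfφ , wfψ) ρ = let bφ , bψ = AllP.++⁻ (vars φ) b in
          ⇔.trans (dnf-represents φ bφ wfφ ρ ×-⇔ dnf-represents ψ bψ wfψ ρ) (DSat-∧ _ _ _)
        dnf-represents (φ ∨ᵘ ψ) b (wfφ , wfψ) ρ = let bφ , bψ = AllP.++⁻ (vars φ) b in
          ⇔.trans (dnf-represents φ bφ wfφ ρ ⊎-⇔ dnf-represents ψ bψ wfψ ρ) (↔⇒⇔ AnyP.++↔)
        dnf-represents (∃ᵘ x φ) (_ ∷ b) wf ρ =
          ⇔.trans (Σ.congˡ λ {d} → dnf-represents φ b wf (ρ [ x ↦ d ])) (DSat-∃ ρ x (dnf φ))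
        dnf-represents (¬ᵘ φ) b (wf , unique) ρ = begin
          ¬ semU φ ρ                                          ∼⟨ ¬-cong-⇔ diamond ⟩
          ¬ semF ⟨ π ⟩ (restrict ρ z)                         ∼⟨ mk⇔ (refl ,_) proj₂ ⟩
          semP ((¬ᶠ ⟨ π ⟩) ?ᵖ) (restrict ρ z) (restrict ρ z)  ∼⟨ ⇔.sym (DSat-progQ _ _ z z) ⟩
          DSat (restrict ρ) (dnf (¬ᵘ φ))                      ∎
          where
          z = freeVar φ
          π = prog (dnf φ) z (other z)
          diamond = ⟨prog⟩-represents φ (dnf-represents φ b wf) wf z (freeVar-unique φ b unique) ρ
        dnf-represents (TC u v φ x y) (u< ∷ v< ∷ x< ∷ y< ∷ b) (wf , u≢v , free-uv) ρ = begin
          TransClosure (λ c d → semU φ ((ρ [ u ↦ c ]) [ v ↦ d ])) (ρ x) (ρ y)  ∼⟨ TransClosure-cong step ⟩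
          TransClosure (semP π) (ρ x) (ρ y)                                 ∼⟨ TransClosure⇔R∘Star ⟩
          semP (π ∘ᵖ π *ᵖ) (ρ x) (ρ y)                                       ≡⟨ cong₂ (semP (π ∘ᵖ π *ᵖ)) x≡ y≡ ⟨
          semP (π ∘ᵖ π *ᵖ) (restrict ρ (var x)) (restrict ρ (var y))         ∼⟨ ⇔.sym (DSat-progQ _ _ _ _) ⟩
          DSat (restrict ρ) (dnf (TC u v φ x y))                             ∎
          where
          π = prog (dnf φ) (var u) (var v)
          x≡ = restrict∘var ρ x<
          y≡ = restrict∘var ρ y<

          step : ∀ c d → semU φ ((ρ [ u ↦ c ]) [ v ↦ d ]) ⇔ semP π c d
          step c d = begin
            semU φ ((ρ [ u ↦ c ]) [ v ↦ d ])     ∼⟨ coincidence-⇔ φ wf agree ⟩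
            semU φ (const c [ v ↦ d ])            ≡⟨ cong (λ t → semU φ (const c [ t ↦ d ])) (toℕ-var v<) ⟨
            semU φ (const c [ toℕ (var v) ↦ d ])  ∼⟨ ⇔.sym (prog-represents φ (dnf-represents φ b wf) u≢v′ c d) ⟩
            semP π c d                            ∎
            where
            u≢v′ = var-≢ u< v< u≢v
            agree : ∀ z → Free z φ → ((ρ [ u ↦ c ]) [ v ↦ d ]) z ≡ (const c [ v ↦ d ]) z
            agree z free with to (free-uv z) free
            ... | inj₁ refl =
              trans ([↦]-minimal _ d u≢v) (trans ([↦]-updates ρ u c) (sym ([↦]-minimal (const c) d u≢v)))
            ... | inj₂ refl = trans ([↦]-updates _ v d) (sym ([↦]-updates (const c) v d))

    unfo→formula : ∀ φ x → WFU φ → (∀ z → Free z φ ⇔ z ≡ x) →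
                   Σ Form λ ψ → WFF ψ ×
                     ((K : Structure) (u : Dom K) → Sem.semU K φ (Sem.asg1 K x u) ⇔ Sem.semF K ψ u)
    unfo→formula φ x wf free = ψ , prog-wf (dnf φ) s (other s) (dnf-wf φ) , correct
      where
      open DNF (max 0 (x ∷ vars φ))
      x<N : x < N
      x<N = All.head (bounded-by-max (x ∷ vars φ))
      b : Bounded N φ
      b = All.tail (bounded-by-max (x ∷ vars φ))
      s = var x
      ψ = ⟨ prog (dnf φ) s (other s) ⟩
      only-s : ∀ {z} → Free z φ → z ≡ toℕ s
      only-s free-z = trans (to (free _) free-z) (sym (toℕ-var x<N))
      correct : (K : Structure) (u : Dom K) → Sem.semU K φ (Sem.asg1 K x u) ⇔ Sem.semF K ψ u
      correct K u = begin
        semU φ (asg1 x u)          ∼⟨ ⟨prog⟩-represents φ (dnf-represents φ b wf) wf s only-s (asg1 x u) ⟩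
        semF ψ (asg1 x u (toℕ s))  ≡⟨ cong (semF ψ) (asg1-const x u (toℕ s)) ⟩
        semF ψ u                   ∎
        where
        open Sem K
        open Valuations K
        open Semantics K

    unfo→program : ∀ φ x y → WFU φ → x ≢ y →
                   Σ Prog λ π → WFP π ×
                     ((K : Structure) (u v : Dom K) → Sem.semU K φ (Sem.asg2 K x y u v) ⇔ Sem.semP K π u v)
    unfo→program φ x y wf x≢y = π , prog-wf (dnf φ) (var x) (var y) (dnf-wf φ) , correct
      where
      open DNF (max 0 (x ∷ y ∷ vars φ))
      x<N : x < N
      x<N = All.head (bounded-by-max (x ∷ y ∷ vars φ))
      y<N : y < N
      y<N = All.head (All.tail (bounded-by-max (x ∷ y ∷ vars φ)))
      b : Bounded N φ
      b = All.tail (All.tail (bounded-by-max (x ∷ y ∷ vars φ)))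
      π = prog (dnf φ) (var x) (var y)
      x≢y′ = var-≢ x<N y<N x≢y
      correct : (K : Structure) (u v : Dom K) → Sem.semU K φ (Sem.asg2 K x y u v) ⇔ Sem.semP K π u v
      correct K u v = begin
        semU φ (asg2 x y u v)                 ∼⟨ coincidence-⇔ φ wf (λ z _ → asg2-≗ x y u v z) ⟩
        semU φ (const u [ y ↦ v ])            ≡⟨ cong (λ t → semU φ (const u [ t ↦ v ])) (toℕ-var y<N) ⟨
        semU φ (const u [ toℕ (var y) ↦ v ])  ∼⟨ ⇔.sym (prog-represents φ (dnf-represents φ b wf) x≢y′ u v) ⟩
        semP π u v                            ∎
        where
        open Sem K
        open Valuations K
        open Semantics K

    -- The free variables of φ are not needed in the binary case: asg2 sends every variable
    -- other than y to u, exactly as the valuation that prog realises does.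
    unfo≤ucpdl : UNFO≤UCPDL
    unfo≤ucpdl = unfo→formula , λ φ x y wf x≢y _ → unfo→program φ x y wf x≢y

mainTheorem8 : (σ : Signature) → Lang.UNFO≤UCPDL σ × Lang.UCPDL≤UNFO σ
mainTheorem8 σ = UNFO→UCPDL.unfo≤ucpdl , UCPDL→UNFO.ucpdl≤unfo
  where open Translations σ
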